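{- Let $k\geq 2$ and $n$ be positive integers. Let $\mu_k(n)$ denote the maximum size of a subset $S\subseteq[n]$ such that there are no elements $a_1,\ldots,a_k\in S$ (not necessarily distinct) with $a_1+\cdots+a_k=n$, and let $\nu_k(n)=\mu_k(n)/n$. Then \[1-\frac{1}{k}\le \nu_k(n)\le 1-\frac{1}{k}+\frac{1}{n}.\]
   Context: For a positive integer $n$, $[n]=\{1,\ldots,n\}$. -}

module Defs where

open import Data.Nat using (ℕ; suc; _+_; _*_; _≤_)
open import Data.Fin using (Fin; toℕ)
open import Data.Fin.Subset using (Subset; _∈_; ∣_∣)
open import Data.Product using (Σ; _×_)
open import Relation.Binary.PropositionalEquality using (_≡_)
open import Relation.Nullary using (¬_)

-- The element of [n] = {1,...,n} represented by i : Fin n is toℕ i + 1.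
elem : ∀ {n} → Fin n → ℕ
elem i = suc (toℕ i)

sumTuple : ∀ {k} → (Fin k → ℕ) → ℕ
sumTuple {ℕ.zero} f = 0
sumTuple {suc k} f = f Fin.zero + sumTuple (λ i → f (Fin.suc i))

NoKSum : (k n : ℕ) → Subset n → Set
NoKSum k n S = ¬ (Σ (Fin k → Fin n) λ a → ((j : Fin k) → a j ∈ S) × sumTuple (λ j → elem (a j)) ≡ n)

IsMu : (k n m : ℕ) → Set
IsMu k n m = Σ (Subset n) (λ S → NoKSum k n S × ∣ S ∣ ≡ m)
           × ((S : Subset n) → NoKSum k n S → ∣ S ∣ ≤ m)

-- Lower bound: the elements of [n] larger than n/k form a k-sum-free set of
-- size n - ⌊n/k⌋. Upper bound: let s be the least element of a k-sum-free S.
-- Then |S| ≤ n - s + 1, and since x + y + (k-2)s = n is forbidden for x, y ∈ S,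
-- at most one of each pair {x, n - (k-2)s - x} lies in S, so
-- 2|S| ≤ n + (k-2)s + 1. Adding (k-2) times the first bound to the second gives
-- k|S| ≤ (k-1)n + k - 1.
module Submission where

open import Defs
open import Data.Nat using (ℕ; zero; suc; _+_; _*_; _∸_; _≤_; _<_; z≤n; s≤s; NonZero)
open import Data.Nat.Properties
open import Data.Nat.DivMod using (_/_; _%_; m≡m%n+[m/n]*n; m%n<n; m/n*n≤m)
open import Data.Nat.Tactic.RingSolver using (solve-∀)
open import Algebra.Properties.CommutativeSemigroup +-commutativeSemigroup using (interchange)
open import Data.Fin as Fin using (Fin; toℕ)
open import Data.Fin.Properties using (toℕ<n)
open import Data.Fin.Subset using (Subset; inside; outside; _∈_; ⊤; ∣_∣; Nonempty)
open import Data.Fin.Subset.Properties using (∈⊤; ∣⊤∣≡n; ∣⊥∣≡0; p⊆q⇒∣p∣≤∣q∣; Empty-unique; nonempty?)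
open import Data.Vec using ([]; _∷_; here; there)
open import Data.Product using (_×_; _,_; ∃)
open import Data.Empty using (⊥; ⊥-elim)
open import Relation.Nullary using (yes; no)
open import Relation.Binary.PropositionalEquality using (_≡_; _≢_; refl; sym; trans; cong; subst; module ≡-Reasoning)

∑ : ℕ → (ℕ → ℕ) → ℕ
∑ zero    f = 0
∑ (suc n) f = f 0 + ∑ n (λ i → f (suc i))

∑-mono-≤ : ∀ n {f g : ℕ → ℕ} → (∀ i → i < n → f i ≤ g i) → ∑ n f ≤ ∑ n g
∑-mono-≤ zero    f≤g = z≤n
∑-mono-≤ (suc n) f≤g = +-mono-≤ (f≤g 0 (s≤s z≤n)) (∑-mono-≤ n (λ i i<n → f≤g (suc i) (s≤s i<n)))

∑-const : ∀ n c → ∑ n (λ _ → c) ≡ n * c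
∑-const zero    c = refl
∑-const (suc n) c = cong (c +_) (∑-const n c)

∑-≤-const : ∀ n c {f : ℕ → ℕ} → (∀ i → i < n → f i ≤ c) → ∑ n f ≤ n * c
∑-≤-const n c f≤c = subst (∑ n _ ≤_) (∑-const n c) (∑-mono-≤ n f≤c)

∑-distrib-+ : ∀ n (f g : ℕ → ℕ) → ∑ n (λ i → f i + g i) ≡ ∑ n f + ∑ n g
∑-distrib-+ zero    f g = refl
∑-distrib-+ (suc n) f g =
  trans (cong (f 0 + g 0 +_) (∑-distrib-+ n (λ i → f (suc i)) (λ i → g (suc i))))
        (interchange (f 0) (g 0) _ _)

∑-split : ∀ m n (f : ℕ → ℕ) → ∑ (m + n) f ≡ ∑ m f + ∑ n (λ i → f (m + i))
∑-split zero    n f = refl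
∑-split (suc m) n f = trans (cong (f 0 +_) (∑-split m n (λ i → f (suc i)))) (sym (+-assoc (f 0) _ _))

∑-snoc : ∀ n (f : ℕ → ℕ) → ∑ (suc n) f ≡ ∑ n f + f n
∑-snoc zero    f = +-comm (f 0) 0
∑-snoc (suc n) f = trans (cong (f 0 +_) (∑-snoc n (λ i → f (suc i)))) (sym (+-assoc (f 0) _ _))

∑-reverse : ∀ n (f : ℕ → ℕ) → ∑ n f ≡ ∑ n (λ i → f (n ∸ suc i))
∑-reverse zero    f = refl
∑-reverse (suc n) f = trans (∑-snoc n f) (trans (+-comm (∑ n f) (f n)) (cong (f n +_) (∑-reverse n f)))

∑-reflect : ∀ n c (f : ℕ → ℕ) → (∀ i → i < n → f i + f (n ∸ suc i) ≤ c) → 2 * ∑ n f ≤ n * c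
∑-reflect n c f paired = begin
  2 * ∑ n f                                 ≡⟨ cong (∑ n f +_) (+-identityʳ (∑ n f)) ⟩
  ∑ n f + ∑ n f                             ≡⟨ cong (∑ n f +_) (∑-reverse n f) ⟩
  ∑ n f + ∑ n (λ i → f (n ∸ suc i))         ≡⟨ ∑-distrib-+ n f (λ i → f (n ∸ suc i)) ⟨
  ∑ n (λ i → f i + f (n ∸ suc i))           ≤⟨ ∑-≤-const n c paired ⟩
  n * c                                     ∎
  where open ≤-Reasoning

-- The suc clause comes first so that χ (b ∷ p) (suc i) reduces for a variable bit b.
χ : ∀ {n} → Subset n → ℕ → ℕ
χ []            _       = 0
χ (_       ∷ p) (suc i) = χ p i
χ (inside  ∷ p) zero    = 1
χ (outside ∷ p) zero    = 0

χ≤1 : ∀ {n} (p : Subset n) i → χ p i ≤ 1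
χ≤1 []            _       = z≤n
χ≤1 (_       ∷ p) (suc i) = χ≤1 p i
χ≤1 (inside  ∷ p) zero    = s≤s z≤n
χ≤1 (outside ∷ p) zero    = z≤n

χ≡1⇒∈ : ∀ {n} (p : Subset n) i → χ p i ≡ 1 → ∃ λ x → toℕ x ≡ i × x ∈ p
χ≡1⇒∈ (inside ∷ p) zero    _ = Fin.zero , refl , here
χ≡1⇒∈ (_      ∷ p) (suc i) e with χ≡1⇒∈ p i e
... | x , x≡i , x∈p = Fin.suc x , cong suc x≡i , there x∈p

∣p∣≡∑χ : ∀ {n} (p : Subset n) → ∣ p ∣ ≡ ∑ n (χ p)
∣p∣≡∑χ []            = refl
∣p∣≡∑χ (inside  ∷ p) = cong suc (∣p∣≡∑χ p)
∣p∣≡∑χ (outside ∷ p) = ∣p∣≡∑χ p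

bits-+-≤1 : ∀ {a b} → a ≤ 1 → b ≤ 1 → (a ≡ 1 → b ≡ 1 → ⊥) → a + b ≤ 1
bits-+-≤1 z≤n       b≤1       _    = b≤1
bits-+-≤1 (s≤s z≤n) z≤n       _    = s≤s z≤n
bits-+-≤1 (s≤s z≤n) (s≤s z≤n) both = ⊥-elim (both refl refl)

-- Elements x < m pair off as x + y = m - 1; the n - m elements ≥ m are unconstrained.
pair-free-card : ∀ {n} (p : Subset n) m → m ≤ n →
                 (∀ {x y} → x ∈ p → y ∈ p → suc (toℕ x + toℕ y) ≢ m) →
                 2 * ∣ p ∣ + m ≤ 2 * n
pair-free-card {n} p m m≤n pair-free = begin
  2 * ∣ p ∣ + m                   ≡⟨ cong (λ c → 2 * c + m) (trans (∣p∣≡∑χ p) split) ⟩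
  2 * (low + high) + m            ≡⟨ rearrange low high m ⟩
  2 * low + (2 * high + m)        ≤⟨ +-mono-≤ low-paired (+-monoˡ-≤ m (*-monoʳ-≤ 2 high≤r)) ⟩
  m * 1 + (2 * (r * 1) + m)       ≡⟨ regroup m r ⟩
  2 * (m + r)                     ≡⟨ cong (2 *_) (m+[n∸m]≡n m≤n) ⟩
  2 * n                           ∎
  where
  open ≤-Reasoning
  r = n ∸ m
  low = ∑ m (χ p)
  high = ∑ r (λ i → χ p (m + i))
  split : ∑ n (χ p) ≡ low + high
  split = trans (cong (λ l → ∑ l (χ p)) (sym (m+[n∸m]≡n m≤n))) (∑-split m r (χ p))
  rearrange : ∀ a b c → 2 * (a + b) + c ≡ 2 * a + (2 * b + c)
  rearrange = solve-∀
  regroup : ∀ a b → a * 1 + (2 * (b * 1) + a) ≡ 2 * (a + b)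
  regroup = solve-∀
  high≤r : high ≤ r * 1
  high≤r = ∑-≤-const r 1 (λ i _ → χ≤1 p (m + i))
  low-paired : 2 * low ≤ m * 1
  low-paired = ∑-reflect m 1 (χ p) paired
    where
    paired : ∀ i → i < m → χ p i + χ p (m ∸ suc i) ≤ 1
    paired i i<m = bits-+-≤1 (χ≤1 p i) (χ≤1 p _) both-in
      where
      both-in : χ p i ≡ 1 → χ p (m ∸ suc i) ≡ 1 → ⊥
      both-in χi χj with χ≡1⇒∈ p i χi | χ≡1⇒∈ p (m ∸ suc i) χj
      ... | x , refl , x∈p | y , y≡ , y∈p =
        pair-free x∈p y∈p (trans (cong (λ j → suc (toℕ x + j)) y≡) (m+[n∸m]≡n i<m))

atLeast : ∀ {n} → ℕ → Subset n
atLeast             zero    = ⊤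
atLeast {n = zero}  (suc t) = []
atLeast {n = suc n} (suc t) = outside ∷ atLeast t

∣atLeast∣ : ∀ n t → ∣ atLeast {n} t ∣ ≡ n ∸ t
∣atLeast∣ n       zero    = ∣⊤∣≡n n
∣atLeast∣ zero    (suc t) = refl
∣atLeast∣ (suc n) (suc t) = ∣atLeast∣ n t

∈atLeast⁺ : ∀ {n} t {x : Fin n} → t ≤ toℕ x → x ∈ atLeast t
∈atLeast⁺ zero    _                     = ∈⊤
∈atLeast⁺ (suc t) {Fin.suc x} (s≤s t≤x) = there (∈atLeast⁺ t t≤x)

∈atLeast⁻ : ∀ {n} t {x : Fin n} → x ∈ atLeast t → t ≤ toℕ x
∈atLeast⁻ zero    _                  = z≤n
∈atLeast⁻ {suc n} (suc t) (there x∈) = s≤s (∈atLeast⁻ t x∈)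

least-element : ∀ {n} (p : Subset n) → Nonempty p → ∃ λ x → x ∈ p × (∀ {y} → y ∈ p → toℕ x ≤ toℕ y)
least-element (inside  ∷ p) _                      = Fin.zero , here , λ _ → z≤n
least-element (outside ∷ p) (Fin.suc x , there x∈p) with least-element p (x , x∈p)
... | y , y∈p , y-least = Fin.suc y , there y∈p , suc-least
  where
  suc-least : ∀ {z} → z ∈ outside ∷ p → suc (toℕ y) ≤ toℕ z
  suc-least (there z∈p) = s≤s (y-least z∈p)

sumTuple-mono-≤ : ∀ {k} {f g : Fin k → ℕ} → (∀ j → f j ≤ g j) → sumTuple f ≤ sumTuple g
sumTuple-mono-≤ {zero}  f≤g = z≤n
sumTuple-mono-≤ {suc k} f≤g = +-mono-≤ (f≤g Fin.zero) (sumTuple-mono-≤ (λ j → f≤g (Fin.suc j)))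

sumTuple-const : ∀ k c → sumTuple {k} (λ _ → c) ≡ k * c
sumTuple-const zero    c = refl
sumTuple-const (suc k) c = cong (c +_) (sumTuple-const k c)

large⇒NoKSum : ∀ k n c (S : Subset n) → n < k * c → (∀ {x} → x ∈ S → c ≤ elem x) → NoKSum k n S
large⇒NoKSum k n c S n<kc large (a , a∈S , sum≡n) = <⇒≱ n<kc (begin
  k * c                        ≡⟨ sumTuple-const k c ⟨
  sumTuple {k} (λ _ → c)       ≤⟨ sumTuple-mono-≤ (λ j → large (a∈S j)) ⟩
  sumTuple (λ j → elem (a j))  ≡⟨ sum≡n ⟩
  n                            ∎)
  where open ≤-Reasoning

NoKSum⇒two-plus-copies≢ : ∀ k n (S : Subset n) {x y z} → NoKSum (2 + k) n S →
                          x ∈ S → y ∈ S → z ∈ S → elem x + (elem y + k * elem z) ≢ n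
NoKSum⇒two-plus-copies≢ k n S {x} {y} {z} free x∈S y∈S z∈S sum≡n = free (a , a∈S , sum≡)
  where
  a : Fin (2 + k) → Fin n
  a Fin.zero                 = x
  a (Fin.suc Fin.zero)       = y
  a (Fin.suc (Fin.suc _))    = z
  a∈S : ∀ j → a j ∈ S
  a∈S Fin.zero               = x∈S
  a∈S (Fin.suc Fin.zero)     = y∈S
  a∈S (Fin.suc (Fin.suc _))  = z∈S
  sum≡ : sumTuple (λ j → elem (a j)) ≡ n
  sum≡ = trans (cong (λ t → elem x + (elem y + t)) (sumTuple-const k (elem z))) sum≡n

m<n*[1+m/n] : ∀ m n .{{_ : NonZero n}} → m < n * suc (m / n)
m<n*[1+m/n] m n = begin-strict
  m                  ≡⟨ m≡m%n+[m/n]*n m n ⟩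
  m % n + m / n * n  <⟨ +-monoˡ-< (m / n * n) (m%n<n m n) ⟩
  n + m / n * n      ≡⟨ *-comm (suc (m / n)) n ⟩
  n * suc (m / n)    ∎
  where open ≤-Reasoning

atLeast-NoKSum : ∀ k n .{{_ : NonZero k}} → NoKSum k n (atLeast (n / k))
atLeast-NoKSum k n = large⇒NoKSum k n (suc (n / k)) _ (m<n*[1+m/n] n k)
                                  (λ x∈S → s≤s (∈atLeast⁻ (n / k) x∈S))

n*[k∸1]≤[n∸n/k]*k : ∀ n k .{{_ : NonZero k}} → n * (k ∸ 1) ≤ (n ∸ n / k) * k
n*[k∸1]≤[n∸n/k]*k n k = begin
  n * (k ∸ 1)        ≡⟨ *-distribˡ-∸ n k 1 ⟩
  n * k ∸ n * 1      ≡⟨ cong (n * k ∸_) (*-identityʳ n) ⟩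
  n * k ∸ n          ≤⟨ ∸-monoʳ-≤ (n * k) (m/n*n≤m n k) ⟩
  n * k ∸ n / k * k  ≡⟨ *-distribʳ-∸ k n (n / k) ⟨
  (n ∸ n / k) * k    ∎
  where open ≤-Reasoning

NoKSum⇒card-bound : ∀ k n (S : Subset n) → NoKSum (2 + k) n S → ∣ S ∣ * (2 + k) ≤ n * (1 + k) + (2 + k)
NoKSum⇒card-bound k n S free with nonempty? S
... | no empty = subst (λ c → c * (2 + k) ≤ _) (sym (trans (cong ∣_∣ (Empty-unique empty)) (∣⊥∣≡0 n))) z≤n
... | yes nonempty with least-element S nonempty
...   | z , z∈S , z-least = combine ∣ S ∣ (toℕ z) (n ∸ T) above paired (m≤n+m∸n n T)
  where
  T = suc (k * elem z)
  above : ∣ S ∣ + toℕ z ≤ n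
  above = m≤o∸n⇒m+n≤o ∣ S ∣ (<⇒≤ (toℕ<n z))
            (subst (∣ S ∣ ≤_) (∣atLeast∣ n (toℕ z))
              (p⊆q⇒∣p∣≤∣q∣ (λ y∈S → ∈atLeast⁺ (toℕ z) (z-least y∈S))))
  paired : 2 * ∣ S ∣ + (n ∸ T) ≤ 2 * n
  paired = pair-free-card S (n ∸ T) (m∸n≤m n T) no-pair
    where
    no-pair : ∀ {x y} → x ∈ S → y ∈ S → suc (toℕ x + toℕ y) ≢ n ∸ T
    no-pair {x} {y} x∈S y∈S pair≡ = NoKSum⇒two-plus-copies≢ k n S free x∈S y∈S z∈S (begin
      elem x + (elem y + k * elem z)  ≡⟨ shift (toℕ x) (toℕ y) (k * elem z) ⟩
      suc (toℕ x + toℕ y) + T         ≡⟨ cong (_+ T) pair≡ ⟩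
      n ∸ T + T                       ≡⟨ m∸n+n≡m {n} {T} (<⇒≤ (m∸n≢0⇒n<m (λ n∸T≡0 → 1+n≢0 (trans pair≡ n∸T≡0)))) ⟩
      n                               ∎)
      where
      open ≡-Reasoning
      shift : ∀ i j c → suc i + (suc j + c) ≡ suc (i + j) + suc c
      shift = solve-∀
  combine : ∀ a s d → a + s ≤ n → 2 * a + d ≤ 2 * n → n ≤ suc (k * suc s) + d →
            a * (2 + k) ≤ n * (1 + k) + (2 + k)
  combine a s d a+s≤n 2a+d≤2n n≤T+d = +-cancelʳ-≤ n _ _ (begin
    a * (2 + k) + n                     ≤⟨ +-monoʳ-≤ (a * (2 + k)) n≤T+d ⟩
    a * (2 + k) + (suc (k * suc s) + d) ≡⟨ regroup k a s d ⟩
    (2 * a + d) + k * (a + s) + suc k   ≤⟨ +-monoˡ-≤ (suc k) (+-mono-≤ 2a+d≤2n (*-monoʳ-≤ k a+s≤n)) ⟩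
    2 * n + k * n + suc k               ≡⟨ regroup′ k n ⟩
    n * (1 + k) + suc k + n             ≤⟨ +-monoˡ-≤ n (+-monoʳ-≤ (n * (1 + k)) (n≤1+n (suc k))) ⟩
    n * (1 + k) + (2 + k) + n           ∎)
    where
    open ≤-Reasoning
    regroup : ∀ l a s d → a * (2 + l) + (suc (l * suc s) + d) ≡ (2 * a + d) + l * (a + s) + suc l
    regroup = solve-∀
    regroup′ : ∀ l n → 2 * n + l * n + suc l ≡ n * (1 + l) + suc l + n
    regroup′ = solve-∀

proposition2p1 : (k n m : ℕ) → 2 ≤ k → 0 < n → IsMu k n m →
    (n * (k ∸ 1) ≤ m * k) × (m * k ≤ n * (k ∸ 1) + k)
proposition2p1 (suc (suc k)) n m (s≤s (s≤s z≤n)) _ ((S , S-free , ∣S∣≡m) , maximal) =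
  lower , subst (λ c → c * (2 + k) ≤ n * (1 + k) + (2 + k)) ∣S∣≡m (NoKSum⇒card-bound k n S S-free)
  where
  lower : n * (1 + k) ≤ m * (2 + k)
  lower = ≤-trans (n*[k∸1]≤[n∸n/k]*k n (2 + k))
            (*-monoˡ-≤ (2 + k) (subst (_≤ m) (∣atLeast∣ n (n / (2 + k)))
              (maximal (atLeast (n / (2 + k))) (atLeast-NoKSum (2 + k) n))))
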